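{- Let $H$ be a connected hypergraph, $p\ge1$, and $f\in\mathcal V_p(H)$ with $f_1(v)+\cdots+f_p(v)\ge d_H(v)$ for all $v\in V(H)$, such that $H$ is not $f$-partitionable. Then: (a) $f_1(v)+f_2(v)+\cdots+f_p(v)=d_H(v)$ for all $v\in V(H)$; (b) if $z$ is a non-separating vertex of $H$ with $f_j(z)\ne0$ for some $j\in\{1,\dots,p\}$, then $f_j(v)\ge\mu_H(z,v)$ for all $v\in V(H)\setminus\{z\}$; (c) if $|V(H)|\ge2$ and $u$ is any vertex of $H$, then $H-u$ admits an $f$-partition (with respect to the restriction of $f$ to $V(H)\setminus\{u\}$), and for every such $f$-partition $(H_1,\dots,H_p)$ of $H-u$ one has $f_i(u)=d_{H_i+u}(u)$ for all $i\in\{1,\dots,p\}$ and $E_H(u)=E_{H_1+u}(u)\cup E_{H_2+u}(u)\cup\cdots\cup E_{H_p+u}(u)$.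
   Context: A hypergraph $H=(V,E,i)$ consists of finite sets $V(H)$, $E(H)$ and an incidence function $i_H:E\to 2^V$ with $|i(e)|\ge 2$ (parallel edges allowed). $H[X]$ is the subhypergraph with vertex set $X$ and edges $e$ with $i_H(e)\subseteq X$ (induced subhypergraph); $H-u=H[V(H)\setminus\{u\}]$, and for an induced subhypergraph $H'$ not containing $u$, $H'+u=H[V(H')\cup\{u\}]$. $E_G(u)$ is the set of edges $e$ of $G$ with $u\in i_G(e)$ and $d_G(u)=|E_G(u)|$. For distinct $u,v$, $\mu_H(u,v)$ is the number of edges $e$ with $i_H(e)=\{u,v\}$. $H$ is connected if nonempty and for every $\emptyset\ne X\subsetneq V(H)$ some edge meets both $X$ and its complement. A vertex $v$ is separating if $H$ is the union of two induced subhypergraphs $H_1,H_2$ with $V(H_1)\cap V(H_2)=\{v\}$ and $|V(H_i)|\ge2$. For $h:V(H)\to\mathbb N_0$, $H$ is strictly $h$-degenerate if every nonempty subhypergraph $G$ has a vertex $v$ with $d_G(v)<h(v)$. $\mathcal V_p(H)$ is the set of $f=(f_1,\dots,f_p):V(H)\to\mathbb N_0^p$. An $f$-partition is a sequence $(H_1,\dots,H_p)$ of pairwise vertex-disjoint, possibly empty, induced subhypergraphs covering $V(H)$ with each $H_i$ strictly $f_i$-degenerate; $H$ is $f$-partitionable if one exists. -}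

module Defs where

open import Data.Nat using (ℕ; _≤_; _<_)
open import Data.Fin using (Fin; _≟_)
open import Data.Fin.Subset using (Subset; _∈_; _∉_; _⊆_; _∩_; _∪_; ⁅_⁆; ∁; ∣_∣; Nonempty; ⊤)
open import Data.Fin.Subset.Properties using (_∈?_; _⊆?_)
open import Data.Vec using (Vec; tabulate; sum)
open import Data.Vec.Properties using (≡-dec)
open import Data.Bool using (Bool)
import Data.Bool.Properties as BP
open import Data.Product using (Σ; ∃; ∃-syntax; _×_)
open import Data.Sum using (_⊎_)
open import Relation.Nullary using (does; ¬_)
open import Relation.Binary.PropositionalEquality using (_≡_)

-- A finite hypergraph: vertices Fin nv, edges Fin ne (parallel edges allowed),
-- incidence function inc : E → 2^V with |inc e| ≥ 2.
record Hypergraph : Set where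
  field
    nv  : ℕ
    ne  : ℕ
    inc : Fin ne → Subset nv
    inc-size : ∀ e → 2 ≤ ∣ inc e ∣

module _ (H : Hypergraph) where
  open Hypergraph H

  V : Set
  V = Fin nv

  star : V → Subset ne
  star v = tabulate (λ e → does (v ∈? inc e))

  -- d_G(v) for the subhypergraph G with edge set F
  deg : Subset ne → V → ℕ
  deg F v = ∣ F ∩ star v ∣

  degH : V → ℕ
  degH v = deg ⊤ v

  induced : Subset nv → Subset ne
  induced X = tabulate (λ e → does (inc e ⊆? X))

  starIn : Subset nv → V → Subset ne
  starIn X v = induced X ∩ star v

  mu : V → V → ℕ
  mu u v = ∣ tabulate (λ e → does (≡-dec BP._≟_ (inc e) (⁅ u ⁆ ∪ ⁅ v ⁆))) ∣

  Connected : Set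
  Connected = Nonempty (⊤ {nv}) ×
    (∀ (X : Subset nv) → Nonempty X → (∃[ w ] w ∉ X) →
      ∃[ e ] ((∃[ x ] (x ∈ inc e × x ∈ X)) × (∃[ y ] (y ∈ inc e × y ∉ X))))

  Separating : V → Set
  Separating v = ∃[ X₁ ] ∃[ X₂ ]
    ((∀ w → w ∈ X₁ ⊎ w ∈ X₂) ×
     (∀ e → inc e ⊆ X₁ ⊎ inc e ⊆ X₂) ×
     (v ∈ X₁ × v ∈ X₂) × (∀ w → w ∈ X₁ → w ∈ X₂ → w ≡ v) ×
     (2 ≤ ∣ X₁ ∣ × 2 ≤ ∣ X₂ ∣))

  IsSub : Subset nv → Subset ne → Set
  IsSub Y F = ∀ e → e ∈ F → inc e ⊆ Y

  StrictlyDegenerate : Subset nv → (V → ℕ) → Set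
  StrictlyDegenerate X h = ∀ (Y : Subset nv) (F : Subset ne) →
    Y ⊆ X → IsSub Y F → Nonempty Y → ∃[ v ] (v ∈ Y × deg F v < h v)

  -- f-partition (H[P 1], …, H[P p]) of the induced subhypergraph H[W];
  -- f : Fin p → V → ℕ with f i v = f_i(v) (restriction to W is implicit,
  -- since degeneracy of H[P i] ⊆ H[W] only looks at vertices of P i).
  IsFPartition : (p : ℕ) → (Fin p → V → ℕ) → Subset nv → (Fin p → Subset nv) → Set
  IsFPartition p f W P =
    (∀ i j v → v ∈ P i → v ∈ P j → i ≡ j) ×
    (∀ v → v ∈ W → ∃[ i ] v ∈ P i) ×
    (∀ i → P i ⊆ W) ×
    (∀ i → StrictlyDegenerate (P i) (f i))

  FPartitionable : (p : ℕ) → (Fin p → V → ℕ) → Subset nv → Set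
  FPartitionable p f W = ∃[ P ] IsFPartition p f W P

  fsum : (p : ℕ) → (Fin p → V → ℕ) → V → ℕ
  fsum p f v = sum (tabulate (λ i → f i v))

module Submission where

-- Two facts drive the proof.  (1) Greedy extension: if w has fewer than f_i(w) edges
-- inside H[P_i + w], then P_i + w is still strictly f_i-degenerate, so an f-partition
-- grows vertex by vertex as long as each new vertex has room in some class.
-- (2) Pigeonhole at a vertex: for disjoint classes the edge sets E_{H[P_i+w]}(w) are
-- disjoint subsets of E_H(w); as Σ_i f_i(w) ≥ d_H(w), some class has room for w as soon
-- as an edge at w is missed by all of them, or class j is overloaded.
--
-- In a connected H every nonempty X ⊆ V ∖ {u} has a vertex with an edge leaving X, so the
-- greedy procedure f-partitions H - u.  If H is not f-partitionable, u fits into no class,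
-- and Σ_i f_i(u) ≥ d_H(u) ≥ Σ_i d_{H_i+u}(u) ≥ Σ_i f_i(u) yields (c) and then (a).  For (b),
-- f_j(v) < μ_H(z,v) would let the greedy procedure, started with z alone in class j,
-- f-partition all of H, using that z is not separating.

open import Defs
open import Data.Nat using (ℕ; _≤_; _≥_)
open import Data.Fin using (Fin)
open import Data.Fin.Subset using (Subset; _∈_; ⊤; ⁅_⁆; ∁; _∪_)
open import Data.Product using (_×_; ∃-syntax; _,_; proj₁; proj₂)
open import Relation.Nullary using (¬_)
open import Relation.Binary.PropositionalEquality using (_≡_; _≢_)

open import Data.Nat using (zero; suc; _<_; _+_; z≤n; s≤s; _<?_)
open import Data.Nat.Properties
  using (≤-trans; ≤-reflexive; ≤-antisym; <-irrefl; ≤-<-trans; <⇒≤; ≮⇒≥;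
         +-suc; +-mono-≤; +-monoʳ-≤; +-mono-<-≤; +-mono-≤-<; n≢0⇒n>0)
open import Data.Fin using (zero; suc) renaming (_≟_ to _≟ᶠ_)
open import Data.Fin.Properties using (any?; suc-injective)
open import Data.Fin.Subset using (_∉_; _⊆_; _⊂_; ⊥; _∩_; _─_; _-_; ∣_∣; Nonempty; inside; outside)
open import Data.Fin.Subset.Properties
open import Data.Fin.Subset.Induction using (Acc; acc; ⊂-wellFounded)
open import Data.Vec using ([]; _∷_; tabulate; sum; here; there)
open import Data.Vec.Properties using (≡-dec; lookup∘tabulate; []=⇒lookup; lookup⇒[]=)
open import Data.Vec.Functional using (updateAt)
open import Data.Vec.Functional.Properties using (updateAt-updates; updateAt-minimal)
import Data.Bool.Properties as Bool
open import Data.Sum using (_⊎_; inj₁; inj₂)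
open import Data.Empty using (⊥-elim)
open import Relation.Nullary using (Dec; yes; no; does)
open import Relation.Nullary.Decidable using (dec-true; _×-dec_; ¬?)
open import Relation.Binary.PropositionalEquality using (refl; sym; trans; cong; subst)

∈-tabulate⁺ : ∀ {n} {P : Fin n → Set} (P? : ∀ x → Dec (P x)) {x} →
  P x → x ∈ tabulate (λ y → does (P? y))
∈-tabulate⁺ P? {x} px = lookup⇒[]= x _ (trans (lookup∘tabulate _ x) (dec-true (P? x) px))

∈-tabulate⁻ : ∀ {n} {P : Fin n → Set} (P? : ∀ x → Dec (P x)) {x} →
  x ∈ tabulate (λ y → does (P? y)) → P x
∈-tabulate⁻ P? {x} x∈ with P? x | trans (sym (lookup∘tabulate _ x)) ([]=⇒lookup x∈)
... | yes px | _  = px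
... | no  _  | ()

x∈p─q⇒x∉q : ∀ {n} (p q : Subset n) {x} → x ∈ p ─ q → x ∉ q
x∈p─q⇒x∉q (_ ∷ p) (outside ∷ q) {zero}  _         ()
x∈p─q⇒x∉q (_ ∷ p) (inside ∷ q)  {zero}  ()        _
x∈p─q⇒x∉q (_ ∷ p) (_ ∷ q)       {suc x} (there h) (there h') = x∈p─q⇒x∉q p q h h'

∣p∣+∣q∣≤∣p∪q∣ : ∀ {n} (p q : Subset n) → (∀ x → x ∈ p → x ∉ q) → ∣ p ∣ + ∣ q ∣ ≤ ∣ p ∪ q ∣
∣p∣+∣q∣≤∣p∪q∣ []            []            _  = z≤n
∣p∣+∣q∣≤∣p∪q∣ (inside ∷ p)  (inside ∷ q)  dj = ⊥-elim (dj zero here here)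
∣p∣+∣q∣≤∣p∪q∣ (inside ∷ p)  (outside ∷ q) dj =
  s≤s (∣p∣+∣q∣≤∣p∪q∣ p q (λ x a b → dj (suc x) (there a) (there b)))
∣p∣+∣q∣≤∣p∪q∣ (outside ∷ p) (inside ∷ q)  dj = subst (_≤ suc ∣ p ∪ q ∣) (sym (+-suc ∣ p ∣ ∣ q ∣))
  (s≤s (∣p∣+∣q∣≤∣p∪q∣ p q (λ x a b → dj (suc x) (there a) (there b))))
∣p∣+∣q∣≤∣p∪q∣ (outside ∷ p) (outside ∷ q) dj =
  ∣p∣+∣q∣≤∣p∪q∣ p q (λ x a b → dj (suc x) (there a) (there b))

reinsert⊆ : ∀ {n} (B X : Subset n) {w} → w ∈ X → (B ∪ (X - w)) ∪ ⁅ w ⁆ ⊆ B ∪ X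
reinsert⊆ B X {w} w∈X {x} x∈ with x∈p∪q⁻ (B ∪ (X - w)) ⁅ w ⁆ x∈
... | inj₂ x∈w = x∈p∪q⁺ (inj₂ (subst (_∈ X) (sym (x∈⁅y⁆⇒x≡y w x∈w)) w∈X))
... | inj₁ x∈BX with x∈p∪q⁻ B (X - w) x∈BX
...   | inj₁ x∈B = x∈p∪q⁺ (inj₁ x∈B)
...   | inj₂ x∈X = x∈p∪q⁺ (inj₂ (p─q⊆p X ⁅ w ⁆ x∈X))

reinsert⊇ : ∀ {n} (B X : Subset n) w → B ∪ X ⊆ (B ∪ (X - w)) ∪ ⁅ w ⁆
reinsert⊇ B X w {x} x∈ with x∈p∪q⁻ B X x∈ | x ≟ᶠ w
... | _        | yes refl = x∈p∪q⁺ (inj₂ (x∈⁅x⁆ w))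
... | inj₁ x∈B | no  _    = x∈p∪q⁺ (inj₁ (x∈p∪q⁺ (inj₁ x∈B)))
... | inj₂ x∈X | no  x≢w  = x∈p∪q⁺ (inj₁ (x∈p∪q⁺ (inj₂ (x∈p∧x≢y⇒x∈p-y x∈X x≢w))))

∉B∪X-w : ∀ {n} (B X : Subset n) w {y} → y ∉ B → y ∉ X → y ∉ B ∪ (X - w)
∉B∪X-w B X w y∉B y∉X y∈ with x∈p∪q⁻ B (X - w) y∈
... | inj₁ y∈B = y∉B y∈B
... | inj₂ y∈X = y∉X (p─q⊆p X ⁅ w ⁆ y∈X)

Disjoint : ∀ {n p} → (Fin p → Subset n) → Set
Disjoint S = ∀ i k x → x ∈ S i → x ∈ S k → i ≡ k

Σ∣disjoint-family∣≤ : ∀ {n p} (S : Fin p → Subset n) (T : Subset n) →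
  Disjoint S → (∀ i → S i ⊆ T) →
  sum (tabulate (λ i → ∣ S i ∣)) ≤ ∣ T ∣
Σ∣disjoint-family∣≤ {p = zero}  S T dj S⊆T = z≤n
Σ∣disjoint-family∣≤ {p = suc p} S T dj S⊆T = begin
  ∣ S zero ∣ + sum (tabulate (λ i → ∣ S (suc i) ∣))
    ≤⟨ +-monoʳ-≤ ∣ S zero ∣ (Σ∣disjoint-family∣≤ (λ i → S (suc i)) (T ─ S zero)
         (λ i k x a b → suc-injective (dj (suc i) (suc k) x a b)) rest⊆) ⟩
  ∣ S zero ∣ + ∣ T ─ S zero ∣
    ≤⟨ ∣p∣+∣q∣≤∣p∪q∣ (S zero) (T ─ S zero) (λ x a b → x∈p─q⇒x∉q T (S zero) b a) ⟩
  ∣ S zero ∪ (T ─ S zero) ∣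
    ≤⟨ p⊆q⇒∣p∣≤∣q∣ union⊆T ⟩
  ∣ T ∣ ∎
  where
  open Data.Nat.Properties.≤-Reasoning
  rest⊆ : ∀ i → S (suc i) ⊆ T ─ S zero
  rest⊆ i x∈ = x∈p∧x∉q⇒x∈p─q (S⊆T (suc i) x∈) (λ x∈₀ → 0≢suc (dj zero (suc i) _ x∈₀ x∈))
    where 0≢suc : zero ≢ suc i
          0≢suc ()
  union⊆T : S zero ∪ (T ─ S zero) ⊆ T
  union⊆T x∈ with x∈p∪q⁻ (S zero) (T ─ S zero) x∈
  ... | inj₁ x∈₀ = S⊆T zero x∈₀
  ... | inj₂ x∈T = p─q⊆p T (S zero) x∈T

Σ-mono-≤ : ∀ {p} (g h : Fin p → ℕ) → (∀ i → g i ≤ h i) → sum (tabulate g) ≤ sum (tabulate h)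
Σ-mono-≤ {zero}  g h g≤h = z≤n
Σ-mono-≤ {suc p} g h g≤h =
  +-mono-≤ (g≤h zero) (Σ-mono-≤ (λ i → g (suc i)) (λ i → h (suc i)) (λ i → g≤h (suc i)))

Σ-mono-< : ∀ {p} (g h : Fin p → ℕ) → (∀ i → g i ≤ h i) → ∀ j → g j < h j →
  sum (tabulate g) < sum (tabulate h)
Σ-mono-< {suc p} g h g≤h zero    g<h =
  +-mono-<-≤ g<h (Σ-mono-≤ (λ i → g (suc i)) (λ i → h (suc i)) (λ i → g≤h (suc i)))
Σ-mono-< {suc p} g h g≤h (suc j) g<h =
  +-mono-≤-< (g≤h zero) (Σ-mono-< (λ i → g (suc i)) (λ i → h (suc i)) (λ i → g≤h (suc i)) j g<h)

witness-of-≰ : ∀ {p} (g h : Fin p → ℕ) → ¬ (∀ i → g i ≤ h i) → ∃[ i ] h i < g i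
witness-of-≰ g h g≰h with any? (λ i → h i <? g i)
... | yes found = found
... | no  none  = ⊥-elim (g≰h (λ i → ≮⇒≥ (λ h<g → none (i , h<g))))

two-members⇒2≤∣∣ : ∀ {n} (S : Subset n) {a b : Fin n} → a ≢ b → a ∈ S → b ∈ S → 2 ≤ ∣ S ∣
two-members⇒2≤∣∣ {n} S {a} {b} a≢b a∈S b∈S = begin
  2                   ≡⟨ cong (λ k → suc (suc k)) (sym (∣⊥∣≡0 n)) ⟩
  suc (suc ∣ ⊥ {n} ∣) ≤⟨ s≤s (p⊂q⇒∣p∣<∣q∣ (⊥⊆ , b , x∈p∧x≢y⇒x∈p-y b∈S (λ b≡a → a≢b (sym b≡a)) , ∉⊥)) ⟩
  suc ∣ S - a ∣       ≤⟨ x∈p⇒∣p-x∣<∣p∣ a∈S ⟩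
  ∣ S ∣               ∎
  where open Data.Nat.Properties.≤-Reasoning

module Hypergraphs (H : Hypergraph) where
  open Hypergraph H

  ∈-star⁺ : ∀ {u e} → u ∈ inc e → e ∈ star H u
  ∈-star⁺ {u} = ∈-tabulate⁺ (λ e → u ∈? inc e)

  ∈-induced⁺ : ∀ {X e} → inc e ⊆ X → e ∈ induced H X
  ∈-induced⁺ {X} = ∈-tabulate⁺ (λ e → inc e ⊆? X)

  ∈-induced⁻ : ∀ {X e} → e ∈ induced H X → inc e ⊆ X
  ∈-induced⁻ {X} = ∈-tabulate⁻ (λ e → inc e ⊆? X)

  edge⊈singleton : ∀ e w → ¬ (inc e ⊆ ⁅ w ⁆)
  edge⊈singleton e w e⊆w = <-irrefl refl
    (≤-trans (inc-size e) (≤-trans (p⊆q⇒∣p∣≤∣q∣ e⊆w) (≤-reflexive (∣⁅x⁆∣≡1 w))))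

  other-vertex : ∀ e w → ∃[ x ] (x ∈ inc e × x ≢ w)
  other-vertex e w with any? (λ x → (x ∈? inc e) ×-dec ¬? (x ≟ᶠ w))
  ... | yes found = found
  ... | no  none  = ⊥-elim (edge⊈singleton e w e⊆w)
    where
    e⊆w : inc e ⊆ ⁅ w ⁆
    e⊆w {x} x∈e with x ≟ᶠ w
    ... | yes refl = x∈⁅x⁆ w
    ... | no  x≢w  = ⊥-elim (none (x , x∈e , x≢w))

  deg-in-singleton : ∀ z → deg H (induced H (⊥ ∪ ⁅ z ⁆)) z ≡ 0
  deg-in-singleton z = trans (cong ∣_∣ (Empty-unique no-edge)) (∣⊥∣≡0 ne)
    where
    no-edge : ¬ Nonempty (induced H (⊥ ∪ ⁅ z ⁆) ∩ star H z)
    no-edge (e , e∈) = edge⊈singleton e z (λ x∈e →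
      subst (_ ∈_) (∪-identityˡ ⁅ z ⁆) (∈-induced⁻ (proj₁ (x∈p∩q⁻ _ _ e∈)) x∈e))

  classStar : ∀ {p} → (Fin p → Subset nv) → V H → Fin p → Subset ne
  classStar P w i = starIn H (P i ∪ ⁅ w ⁆) w

  -- Disjoint classes have disjoint class stars at w: an edge in two of them
  -- would have its second vertex in both classes.
  classStar-disjoint : ∀ {p} {P : Fin p → Subset nv} → Disjoint P → ∀ w → Disjoint (classStar P w)
  classStar-disjoint {P = P} P-disj w i k e e∈i e∈k with other-vertex e w
  ... | x , x∈e , x≢w = P-disj i k x (in-class i e∈i) (in-class k e∈k)
    where
    in-class : ∀ l → e ∈ classStar P w l → x ∈ P l
    in-class l e∈l with x∈p∪q⁻ (P l) ⁅ w ⁆ (∈-induced⁻ (proj₁ (x∈p∩q⁻ _ _ e∈l)) x∈e)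
    ... | inj₁ x∈P = x∈P
    ... | inj₂ x∈w = ⊥-elim (x≢w (x∈⁅y⁆⇒x≡y w x∈w))

  Σ-edges-at≤deg : ∀ {p} (T : Fin p → Subset ne) w → Disjoint T → (∀ i → T i ⊆ star H w) →
    sum (tabulate (λ i → ∣ T i ∣)) ≤ degH H w
  Σ-edges-at≤deg T w T-disj T⊆ =
    Σ∣disjoint-family∣≤ T (⊤ ∩ star H w) T-disj (λ i e∈ → x∈p∩q⁺ (∈⊤ , T⊆ i e∈))

  Σ-edges-at<deg : ∀ {p} (T : Fin p → Subset ne) w → Disjoint T → (∀ i → T i ⊆ star H w) →
    ∀ e → e ∈ star H w → (∀ i → e ∉ T i) → sum (tabulate (λ i → ∣ T i ∣)) < degH H w
  Σ-edges-at<deg T w T-disj T⊆ e e∈w e∉T = ≤-<-trans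
    (Σ∣disjoint-family∣≤ T ((⊤ ∩ star H w) - e) T-disj
      (λ i {d} d∈ → x∈p∧x≢y⇒x∈p-y (x∈p∩q⁺ (∈⊤ , T⊆ i d∈)) (λ { refl → e∉T i d∈ })))
    (x∈p⇒∣p-x∣<∣p∣ (x∈p∩q⁺ (∈⊤ , e∈w)))

  classStar⊆star : ∀ {p} (P : Fin p → Subset nv) w i → classStar P w i ⊆ star H w
  classStar⊆star P w i e∈ = proj₂ (x∈p∩q⁻ _ _ e∈)

  classDeg : ∀ {p} → (Fin p → Subset nv) → V H → Fin p → ℕ
  classDeg P w i = deg H (induced H (P i ∪ ⁅ w ⁆)) w

  Σ-classDeg≤deg : ∀ {p} {P : Fin p → Subset nv} → Disjoint P → ∀ w →
    sum (tabulate (classDeg P w)) ≤ degH H w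
  Σ-classDeg≤deg {P = P} disj w = Σ-edges-at≤deg (classStar P w) w (classStar-disjoint disj w)
    (classStar⊆star P w)

  parallel : V H → V H → Subset ne
  parallel z w = tabulate (λ e → does (≡-dec Bool._≟_ (inc e) (⁅ z ⁆ ∪ ⁅ w ⁆)))

  parallel-at : ∀ z w {e} → e ∈ parallel z w → z ∈ inc e × w ∈ inc e
  parallel-at z w e∈ rewrite ∈-tabulate⁻ (λ e → ≡-dec Bool._≟_ (inc e) (⁅ z ⁆ ∪ ⁅ w ⁆)) e∈ =
    x∈p∪q⁺ (inj₁ (x∈⁅x⁆ z)) , x∈p∪q⁺ (inj₂ (x∈⁅x⁆ w))

  degenerate-⊥ : ∀ h → StrictlyDegenerate H ⊥ h
  degenerate-⊥ h Z F Z⊆⊥ F-sub (z , z∈) = ⊥-elim (∉⊥ (Z⊆⊥ z∈))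

  -- Adding a vertex w of degree d_{H[Q+w]}(w) < h(w) preserves strict h-degeneracy:
  -- a subhypergraph containing w has w itself as a low-degree vertex.
  degenerate-extend : ∀ Q h w → StrictlyDegenerate H Q h →
    deg H (induced H (Q ∪ ⁅ w ⁆)) w < h w → StrictlyDegenerate H (Q ∪ ⁅ w ⁆) h
  degenerate-extend Q h w Q-deg w-low Y F Y⊆ F-sub Y≠∅ with w ∈? Y
  ... | yes w∈Y = w , w∈Y , ≤-<-trans (p⊆q⇒∣p∣≤∣q∣ F-star⊆) w-low
    where
    F-star⊆ : F ∩ star H w ⊆ induced H (Q ∪ ⁅ w ⁆) ∩ star H w
    F-star⊆ e∈ with x∈p∩q⁻ F _ e∈
    ... | e∈F , e∈w = x∈p∩q⁺ (∈-induced⁺ (λ x∈e → Y⊆ (F-sub _ e∈F x∈e)) , e∈w)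
  ... | no  w∉Y = Q-deg Y F Y⊆Q F-sub Y≠∅
    where
    Y⊆Q : Y ⊆ Q
    Y⊆Q {y} y∈Y with x∈p∪q⁻ Q ⁅ w ⁆ (Y⊆ y∈Y)
    ... | inj₁ y∈Q = y∈Q
    ... | inj₂ y∈w = ⊥-elim (w∉Y (subst (_∈ Y) (x∈⁅y⁆⇒x≡y w y∈w) y∈Y))

  cut-vertex : ∀ z X {x v} → z ∉ X → x ∈ X → v ∉ X → v ≢ z →
    (∀ e {a b} → a ∈ inc e → a ∈ X → b ∈ inc e → b ∉ X → b ≡ z) → Separating H z
  cut-vertex z X {x} {v} z∉X x∈X v∉X v≢z closed =
    X ∪ ⁅ z ⁆ , ∁ X , covers , edges-inside , (x∈p∪q⁺ (inj₂ (x∈⁅x⁆ z)) , x∉p⇒x∈∁p z∉X) , meet ,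
    two-members⇒2≤∣∣ (X ∪ ⁅ z ⁆) (λ { refl → z∉X x∈X }) (x∈p∪q⁺ (inj₁ x∈X)) (x∈p∪q⁺ (inj₂ (x∈⁅x⁆ z))) ,
    two-members⇒2≤∣∣ (∁ X) v≢z (x∉p⇒x∈∁p v∉X) (x∉p⇒x∈∁p z∉X)
    where
    covers : ∀ w → w ∈ X ∪ ⁅ z ⁆ ⊎ w ∈ ∁ X
    covers w with w ∈? X
    ... | yes w∈X = inj₁ (x∈p∪q⁺ (inj₁ w∈X))
    ... | no  w∉X = inj₂ (x∉p⇒x∈∁p w∉X)
    edges-inside : ∀ e → inc e ⊆ X ∪ ⁅ z ⁆ ⊎ inc e ⊆ ∁ X
    edges-inside e with any? (λ a → (a ∈? inc e) ×-dec (a ∈? X))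
    ... | no  misses = inj₂ (λ {b} b∈e → x∉p⇒x∈∁p (λ b∈X → misses (b , b∈e , b∈X)))
    ... | yes (a , a∈e , a∈X) = inj₁ λ {b} b∈e → case-in-X b b∈e (b ∈? X)
      where
      case-in-X : ∀ b → b ∈ inc e → Dec (b ∈ X) → b ∈ X ∪ ⁅ z ⁆
      case-in-X b b∈e (yes b∈X) = x∈p∪q⁺ (inj₁ b∈X)
      case-in-X b b∈e (no  b∉X) = x∈p∪q⁺ (inj₂ (subst (_∈ ⁅ z ⁆) (sym (closed e a∈e a∈X b∈e b∉X)) (x∈⁅x⁆ z)))
    meet : ∀ w → w ∈ X ∪ ⁅ z ⁆ → w ∈ ∁ X → w ≡ z
    meet w w∈ w∈∁X with x∈p∪q⁻ X ⁅ z ⁆ w∈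
    ... | inj₁ w∈X = ⊥-elim (x∈∁p⇒x∉p w∈∁X w∈X)
    ... | inj₂ w∈z = x∈⁅y⁆⇒x≡y z w∈z

  escaping-edge : ∀ z X {x v} → ¬ Separating H z → z ∉ X → x ∈ X → v ∉ X → v ≢ z →
    ∃[ e ] ∃[ a ] ∃[ b ] (a ∈ inc e × a ∈ X × b ∈ inc e × b ∉ X × b ≢ z)
  escaping-edge z X non-sep z∉X x∈X v∉X v≢z
    with any? (λ e → any? (λ a → (a ∈? inc e) ×-dec (a ∈? X)) ×-dec
                     any? (λ b → (b ∈? inc e) ×-dec (¬? (b ∈? X) ×-dec ¬? (b ≟ᶠ z))))
  ... | yes (e , (a , a∈e , a∈X) , (b , b∈e , b∉X , b≢z)) = e , a , b , a∈e , a∈X , b∈e , b∉X , b≢z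
  ... | no  none = ⊥-elim (non-sep (cut-vertex z X z∉X x∈X v∉X v≢z closed))
    where
    closed : ∀ e {a b} → a ∈ inc e → a ∈ X → b ∈ inc e → b ∉ X → b ≡ z
    closed e {a} {b} a∈e a∈X b∈e b∉X with b ≟ᶠ z
    ... | yes b≡z = b≡z
    ... | no  b≢z = ⊥-elim (none (e , (a , a∈e , a∈X) , (b , b∈e , b∉X , b≢z)))

module Partitions (H : Hypergraph) (p : ℕ) (f : Fin p → V H → ℕ) where
  open Hypergraph H
  open Hypergraphs H

  Partition : Subset nv → (Fin p → Subset nv) → Set
  Partition = IsFPartition H p f

  empty-partition : Partition ⊥ (λ _ → ⊥)
  empty-partition = (λ i k x x∈ _ → ⊥-elim (∉⊥ x∈)) , (λ v v∈ → ⊥-elim (∉⊥ v∈)) ,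
                    (λ i → ⊥⊆) , (λ i → degenerate-⊥ (f i))

  partition-resp : ∀ {S T P} → S ⊆ T → T ⊆ S → Partition S P → Partition T P
  partition-resp S⊆T T⊆S (disj , cover , P⊆S , P-deg) =
    disj , (λ v v∈T → cover v (T⊆S v∈T)) , (λ i x∈ → S⊆T (P⊆S i x∈)) , P-deg

  addTo : (Fin p → Subset nv) → Fin p → V H → Fin p → Subset nv
  addTo P i w = updateAt P i (_∪ ⁅ w ⁆)

  addTo-⊇ : ∀ P i w k → P k ⊆ addTo P i w k
  addTo-⊇ P i w k x∈ with k ≟ᶠ i
  ... | yes refl = subst (_ ∈_) (sym (updateAt-updates k P)) (x∈p∪q⁺ (inj₁ x∈))
  ... | no  k≢i  = subst (_ ∈_) (sym (updateAt-minimal k i P k≢i)) x∈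

  w∈addTo : ∀ P i w → w ∈ addTo P i w i
  w∈addTo P i w = subst (w ∈_) (sym (updateAt-updates i P)) (x∈p∪q⁺ (inj₂ (x∈⁅x⁆ w)))

  ∈-addTo⁻ : ∀ P i w k {x} → x ∈ addTo P i w k → x ∈ P k ⊎ (k ≡ i × x ≡ w)
  ∈-addTo⁻ P i w k {x} x∈ with k ≟ᶠ i
  ... | no  k≢i  = inj₁ (subst (x ∈_) (updateAt-minimal k i P k≢i) x∈)
  ... | yes refl with x∈p∪q⁻ (P k) ⁅ w ⁆ (subst (x ∈_) (updateAt-updates k P) x∈)
  ...   | inj₁ x∈P = inj₁ x∈P
  ...   | inj₂ x∈w = inj₂ (refl , x∈⁅y⁆⇒x≡y w x∈w)

  extend-partition : ∀ {S P} i w → Partition S P → w ∉ S →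
    classDeg P w i < f i w → Partition (S ∪ ⁅ w ⁆) (addTo P i w)
  extend-partition {S} {P} i w (disj , cover , P⊆S , P-deg) w∉S w-low =
    disj′ , cover′ , P′⊆ , deg′
    where
    P′ : Fin p → Subset nv
    P′ = addTo P i w
    not-w : ∀ k {x} → x ∈ P k → x ≢ w
    not-w k x∈ refl = w∉S (P⊆S k x∈)
    disj′ : Disjoint P′
    disj′ k l x x∈k x∈l with ∈-addTo⁻ P i w k x∈k | ∈-addTo⁻ P i w l x∈l
    ... | inj₁ x∈Pk        | inj₁ x∈Pl        = disj k l x x∈Pk x∈Pl
    ... | inj₁ x∈Pk        | inj₂ (_ , x≡w)   = ⊥-elim (not-w k x∈Pk x≡w)
    ... | inj₂ (_ , x≡w)   | inj₁ x∈Pl        = ⊥-elim (not-w l x∈Pl x≡w)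
    ... | inj₂ (k≡i , _)   | inj₂ (l≡i , _)   = trans k≡i (sym l≡i)
    cover′ : ∀ v → v ∈ S ∪ ⁅ w ⁆ → ∃[ k ] v ∈ P′ k
    cover′ v v∈ with x∈p∪q⁻ S ⁅ w ⁆ v∈
    ... | inj₁ v∈S = let (k , v∈k) = cover v v∈S in k , addTo-⊇ P i w k v∈k
    ... | inj₂ v∈w = i , subst (_∈ P′ i) (sym (x∈⁅y⁆⇒x≡y w v∈w)) (w∈addTo P i w)
    P′⊆ : ∀ k → P′ k ⊆ S ∪ ⁅ w ⁆
    P′⊆ k x∈ with ∈-addTo⁻ P i w k x∈
    ... | inj₁ x∈P       = x∈p∪q⁺ (inj₁ (P⊆S k x∈P))
    ... | inj₂ (_ , refl) = x∈p∪q⁺ (inj₂ (x∈⁅x⁆ w))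
    deg′ : ∀ k → StrictlyDegenerate H (P′ k) (f k)
    deg′ k with k ≟ᶠ i
    ... | yes refl = subst (λ Q → StrictlyDegenerate H Q (f k)) (sym (updateAt-updates k P))
                       (degenerate-extend (P k) (f k) w (P-deg k) w-low)
    ... | no  k≢i  = subst (λ Q → StrictlyDegenerate H Q (f k)) (sym (updateAt-minimal k i P k≢i))
                       (P-deg k)

  Extends : (Fin p → Subset nv) → (Fin p → Subset nv) → Set
  Extends P₀ P = ∀ i → P₀ i ⊆ P i

  Placeable : (Fin p → Subset nv) → Subset nv → V H → Set
  Placeable P₀ S w = ∀ P → Partition S P → Extends P₀ P → ∃[ i ] classDeg P w i < f i w

  -- Greedy colouring: a partition P₀ of B extends to B ∪ W if every nonempty
  -- X ⊆ W has a vertex w that can be placed last, after the rest of B ∪ X.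
  greedy-partition : ∀ {B P₀} W → Partition B P₀ → (∀ x → x ∈ W → x ∉ B) →
    (∀ X → X ⊆ W → Nonempty X → ∃[ w ] (w ∈ X × Placeable P₀ (B ∪ (X - w)) w)) →
    FPartitionable H p f (B ∪ W)
  greedy-partition {B} {P₀} W P₀-part W∉B choose with build W (⊂-wellFounded W) ⊆-refl
    where
    build : ∀ X → Acc _⊂_ X → X ⊆ W → ∃[ P ] (Partition (B ∪ X) P × Extends P₀ P)
    build X (acc smaller) X⊆W with nonempty? X
    ... | no  X=∅ = P₀ , subst (λ S → Partition S P₀) B≡B∪X P₀-part , λ i → ⊆-refl
      where
      B≡B∪X : B ≡ B ∪ X
      B≡B∪X = sym (trans (cong (B ∪_) (Empty-unique X=∅)) (∪-identityʳ B))
    ... | yes X≠∅ with choose X X⊆W X≠∅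
    ... | w , w∈X , placeable
        with build (X - w) (smaller (x∈p⇒p-x⊂p w∈X)) (λ x∈ → X⊆W (p─q⊆p X ⁅ w ⁆ x∈))
    ... | P , P-part , P⊇P₀ with placeable P P-part P⊇P₀
    ... | i , w-low = addTo P i w ,
          partition-resp (reinsert⊆ B X w∈X) (reinsert⊇ B X w)
            (extend-partition i w P-part w∉ w-low) ,
          λ k x∈ → addTo-⊇ P i w k (P⊇P₀ k x∈)
      where
      w∉ : w ∉ B ∪ (X - w)
      w∉ w∈ with x∈p∪q⁻ B (X - w) w∈
      ... | inj₁ w∈B = W∉B w (X⊆W w∈X) w∈B
      ... | inj₂ w∈X = x∈p─q⇒x∉q X ⁅ w ⁆ w∈X (x∈⁅x⁆ w)
  ... | P , P-part , _ = P , P-part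

  room-via-escaping-edge : ∀ {S P} w → fsum H p f w ≥ degH H w → Disjoint P → (∀ i → P i ⊆ S) →
    ∀ e y → w ∈ inc e → y ∈ inc e → y ∉ S → y ≢ w → ∃[ i ] classDeg P w i < f i w
  room-via-escaping-edge {S} {P} w Σf≥deg disj P⊆S e y w∈e y∈e y∉S y≢w =
    witness-of-≰ (λ i → f i w) (classDeg P w) λ f≤ → <-irrefl refl (begin-strict
      fsum H p f w                     ≤⟨ Σ-mono-≤ _ _ f≤ ⟩
      sum (tabulate (classDeg P w))    <⟨ Σ-edges-at<deg (classStar P w) w (classStar-disjoint disj w)
                                            (classStar⊆star P w) e (∈-star⁺ w∈e) e∉ ⟩
      degH H w                         ≤⟨ Σf≥deg ⟩
      fsum H p f w                     ∎)
    where
    open Data.Nat.Properties.≤-Reasoning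
    e∉ : ∀ i → e ∉ classStar P w i
    e∉ i e∈ with x∈p∪q⁻ (P i) ⁅ w ⁆ (∈-induced⁻ (proj₁ (x∈p∩q⁻ _ _ e∈)) y∈e)
    ... | inj₁ y∈P = y∉S (P⊆S i y∈P)
    ... | inj₂ y∈w = y≢w (x∈⁅y⁆⇒x≡y w y∈w)

  -- The edges {z,w} lie in no class
  -- star other than the j-th, so they may replace it in the count.
  room-via-parallel-edges : ∀ {P} w z j → fsum H p f w ≥ degH H w → Disjoint P →
    z ∈ P j → z ≢ w → f j w < mu H z w → ∃[ i ] classDeg P w i < f i w
  room-via-parallel-edges {P} w z j Σf≥deg disj z∈Pj z≢w f<μ =
    witness-of-≰ (λ i → f i w) (classDeg P w) λ f≤ → <-irrefl refl (begin-strict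
      fsum H p f w                      <⟨ Σ-mono-< _ _ (f≤∣T∣ f≤) j f<∣Tj∣ ⟩
      sum (tabulate (λ i → ∣ T i ∣))    ≤⟨ Σ-edges-at≤deg T w T-disj T⊆star ⟩
      degH H w                          ≤⟨ Σf≥deg ⟩
      fsum H p f w                      ∎)
    where
    open Data.Nat.Properties.≤-Reasoning
    T : Fin p → Subset ne
    T = updateAt (classStar P w) j (λ _ → parallel z w)

    ∈T⁻ : ∀ k {e} → e ∈ T k → (k ≡ j × e ∈ parallel z w) ⊎ (k ≢ j × e ∈ classStar P w k)
    ∈T⁻ k {e} e∈ with k ≟ᶠ j
    ... | yes refl = inj₁ (refl , subst (e ∈_) (updateAt-updates k (classStar P w)) e∈)
    ... | no  k≢j  = inj₂ (k≢j , subst (e ∈_) (updateAt-minimal k j (classStar P w) k≢j) e∈)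

    z-only-in-j : ∀ k {e} → e ∈ parallel z w → e ∈ classStar P w k → k ≡ j
    z-only-in-j k e∈par e∈k
      with x∈p∪q⁻ (P k) ⁅ w ⁆ (∈-induced⁻ (proj₁ (x∈p∩q⁻ _ _ e∈k)) (proj₁ (parallel-at z w e∈par)))
    ... | inj₁ z∈Pk = disj k j z z∈Pk z∈Pj
    ... | inj₂ z∈w  = ⊥-elim (z≢w (x∈⁅y⁆⇒x≡y w z∈w))

    T-disj : Disjoint T
    T-disj k l e e∈k e∈l with ∈T⁻ k e∈k | ∈T⁻ l e∈l
    ... | inj₁ (k≡j , _)     | inj₁ (l≡j , _)     = trans k≡j (sym l≡j)
    ... | inj₁ (k≡j , e∈par) | inj₂ (l≢j , e∈l)   = ⊥-elim (l≢j (z-only-in-j l e∈par e∈l))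
    ... | inj₂ (k≢j , e∈k)   | inj₁ (l≡j , e∈par) = ⊥-elim (k≢j (z-only-in-j k e∈par e∈k))
    ... | inj₂ (_ , e∈k)     | inj₂ (_ , e∈l)     = classStar-disjoint disj w k l e e∈k e∈l

    T⊆star : ∀ k → T k ⊆ star H w
    T⊆star k e∈ with ∈T⁻ k e∈
    ... | inj₁ (_ , e∈par) = ∈-star⁺ (proj₂ (parallel-at z w e∈par))
    ... | inj₂ (_ , e∈k)   = classStar⊆star P w k e∈k

    f<∣Tj∣ : f j w < ∣ T j ∣
    f<∣Tj∣ = subst (λ Q → f j w < ∣ Q ∣) (sym (updateAt-updates j (classStar P w))) f<μ

    f≤∣T∣ : (∀ i → f i w ≤ classDeg P w i) → ∀ i → f i w ≤ ∣ T i ∣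
    f≤∣T∣ f≤ i with i ≟ᶠ j
    ... | yes refl = <⇒≤ f<∣Tj∣
    ... | no  i≢j  = subst (λ Q → f i w ≤ ∣ Q ∣) (sym (updateAt-minimal i j (classStar P w) i≢j)) (f≤ i)

module Proposition (H : Hypergraph) (p : ℕ) (f : Fin p → V H → ℕ)
                   (Σf≥deg : ∀ v → fsum H p f v ≥ degH H v) where
  open Hypergraph H
  open Hypergraphs H
  open Partitions H p f
  open Data.Nat.Properties.≤-Reasoning

  -- If f_1+⋯+f_p ≥ d_H, every H - u of a connected H is f-partitionable: order the
  -- vertices so that each has an edge to a later vertex (or to u) and colour greedily.
  H-minus-partitionable : Connected H → ∀ u → FPartitionable H p f (∁ ⁅ u ⁆)
  H-minus-partitionable (_ , crossing) u = subst (FPartitionable H p f) (∪-identityˡ (∁ ⁅ u ⁆))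
    (greedy-partition (∁ ⁅ u ⁆) empty-partition (λ x _ → ∉⊥) choose)
    where
    choose : ∀ X → X ⊆ ∁ ⁅ u ⁆ → Nonempty X →
      ∃[ w ] (w ∈ X × Placeable (λ _ → ⊥) (⊥ ∪ (X - w)) w)
    choose X X⊆ X≠∅ with crossing X X≠∅ (u , λ u∈X → x∈∁p⇒x∉p (X⊆ u∈X) (x∈⁅x⁆ u))
    ... | e , (x , x∈e , x∈X) , (y , y∈e , y∉X) = x , x∈X , λ P (disj , _ , P⊆ , _) _ →
      room-via-escaping-edge x (Σf≥deg x) disj P⊆ e y x∈e y∈e (∉B∪X-w ⊥ X x ∉⊥ y∉X)
        (λ { refl → y∉X x∈X })

  module _ (not-partitionable : ¬ FPartitionable H p f ⊤) (u : V H)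
           (P : Fin p → Subset nv) (P-part : Partition (∁ ⁅ u ⁆) P) where

    -- No class of an f-partition of H - u has room for u, else H would be f-partitionable.
    no-room-for-removed : ∀ i → f i u ≤ classDeg P u i
    no-room-for-removed i = ≮⇒≥ λ u-low → not-partitionable (addTo P i u ,
      subst (λ S → Partition S (addTo P i u)) (trans (∪-comm (∁ ⁅ u ⁆) ⁅ u ⁆) (p∪∁p≡⊤ ⁅ u ⁆))
        (extend-partition i u P-part (λ u∈ → x∈∁p⇒x∉p u∈ (x∈⁅x⁆ u)) u-low))

    Σf≤Σ-classDeg : fsum H p f u ≤ sum (tabulate (classDeg P u))
    Σf≤Σ-classDeg = Σ-mono-≤ _ _ no-room-for-removed

    removed-vertex-tight : ∀ i → f i u ≡ classDeg P u i
    removed-vertex-tight i = ≤-antisym (no-room-for-removed i) (≮⇒≥ λ f<deg → <-irrefl refl (begin-strict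
      fsum H p f u                    <⟨ Σ-mono-< _ _ no-room-for-removed i f<deg ⟩
      sum (tabulate (classDeg P u))   ≤⟨ Σ-classDeg≤deg (proj₁ P-part) u ⟩
      degH H u                        ≤⟨ Σf≥deg u ⟩
      fsum H p f u                    ∎))

    removed-vertex-star-covered : ∀ e → e ∈ star H u → ∃[ i ] e ∈ starIn H (P i ∪ ⁅ u ⁆) u
    removed-vertex-star-covered e e∈u with any? (λ i → e ∈? classStar P u i)
    ... | yes found = found
    ... | no  none  = ⊥-elim (<-irrefl refl (begin-strict
      fsum H p f u                    ≤⟨ Σf≤Σ-classDeg ⟩
      sum (tabulate (classDeg P u))   <⟨ Σ-edges-at<deg (classStar P u) u
                                           (classStar-disjoint (proj₁ P-part) u) (classStar⊆star P u)
                                           e e∈u (λ i e∈i → none (i , e∈i)) ⟩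
      degH H u                        ≤⟨ Σf≥deg u ⟩
      fsum H p f u                    ∎))

  degree-sum-exact : Connected H → ¬ FPartitionable H p f ⊤ → ∀ v → fsum H p f v ≡ degH H v
  degree-sum-exact conn not-partitionable v with H-minus-partitionable conn v
  ... | P , P-part = ≤-antisym
    (≤-trans (Σf≤Σ-classDeg not-partitionable v P P-part) (Σ-classDeg≤deg (proj₁ P-part) v))
    (Σf≥deg v)

  -- Suppose f_j(v) < μ_H(z,v).  Put z alone into class j (possible as
  -- f_j(z) ≥ 1) and colour V ∖ {z} greedily, placing v last among any X ∋ v and
  -- otherwise a vertex of X with an edge leaving X ∪ {z}, which exists as z is not
  -- separating.  This would f-partition H.
  non-separating-bound : ¬ FPartitionable H p f ⊤ → ∀ z → ¬ Separating H z →
    ∀ j → f j z ≢ 0 → ∀ v → v ≢ z → f j v ≥ mu H z v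
  non-separating-bound not-partitionable z non-sep j fjz≢0 v v≢z = ≮⇒≥ λ f<μ →
    not-partitionable (subst (FPartitionable H p f) (p∪∁p≡⊤ ⁅ z ⁆)
      (greedy-partition (∁ ⁅ z ⁆) z-in-j (λ x x∈ x∈z → x∈∁p⇒x∉p x∈ x∈z) (choose f<μ)))
    where
    P₀ : Fin p → Subset nv
    P₀ = addTo (λ _ → ⊥) j z

    z-in-j : Partition ⁅ z ⁆ P₀
    z-in-j = subst (λ S → Partition S P₀) (∪-identityˡ ⁅ z ⁆)
      (extend-partition j z empty-partition ∉⊥
        (subst (_< f j z) (sym (deg-in-singleton z)) (n≢0⇒n>0 fjz≢0)))

    choose : f j v < mu H z v → ∀ X → X ⊆ ∁ ⁅ z ⁆ → Nonempty X →
      ∃[ w ] (w ∈ X × Placeable P₀ (⁅ z ⁆ ∪ (X - w)) w)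
    choose f<μ X X⊆ (x , x∈X) with v ∈? X
    ... | yes v∈X = v , v∈X , λ P (disj , _) P⊇P₀ →
      room-via-parallel-edges v z j (Σf≥deg v) disj (P⊇P₀ j (w∈addTo _ j z)) (λ z≡v → v≢z (sym z≡v)) f<μ
    ... | no  v∉X with escaping-edge z X non-sep z∉X x∈X v∉X v≢z
      where
      z∉X : z ∉ X
      z∉X z∈X = x∈∁p⇒x∉p (X⊆ z∈X) (x∈⁅x⁆ z)
    ...   | e , a , b , a∈e , a∈X , b∈e , b∉X , b≢z = a , a∈X , λ P (disj , _ , P⊆ , _) _ →
      room-via-escaping-edge a (Σf≥deg a) disj P⊆ e b a∈e b∈e
        (∉B∪X-w ⁅ z ⁆ X a (λ b∈z → b≢z (x∈⁅y⁆⇒x≡y z b∈z)) b∉X) (λ { refl → b∉X a∈X })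

proposition2p4 : (H : Hypergraph) → Connected H →
    (p : ℕ) → 1 ≤ p → (f : Fin p → V H → ℕ) →
    (∀ v → fsum H p f v ≥ degH H v) →
    ¬ FPartitionable H p f ⊤ →
    ((∀ v → fsum H p f v ≡ degH H v) ×
    (∀ z → ¬ Separating H z → ∀ j → f j z ≢ 0 → ∀ v → v ≢ z → f j v ≥ mu H z v) ×
    (2 ≤ Hypergraph.nv H → ∀ u →
    FPartitionable H p f (∁ ⁅ u ⁆) ×
    (∀ P → IsFPartition H p f (∁ ⁅ u ⁆) P →
    (∀ i → f i u ≡ deg H (induced H (P i ∪ ⁅ u ⁆)) u) ×
    (∀ e → (e ∈ star H u → ∃[ i ] e ∈ starIn H (P i ∪ ⁅ u ⁆) u) ×
    (∀ i → e ∈ starIn H (P i ∪ ⁅ u ⁆) u → e ∈ star H u)))))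
proposition2p4 H conn p _ f Σf≥deg not-partitionable =
  degree-sum-exact conn not-partitionable ,
  non-separating-bound not-partitionable ,
  λ _ u → H-minus-partitionable conn u , λ P P-part →
    removed-vertex-tight not-partitionable u P P-part ,
    λ e → removed-vertex-star-covered not-partitionable u P P-part e ,
          λ i → classStar⊆star P u i
  where
  open Hypergraphs H
  open Proposition H p f Σf≥deg
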